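{- Let $P$ be the parallelogram polyomino of rectangular shape whose bounding rectangle has dimensions $k\times\ell$. Then the number of Baxter slicings whose underlying polyomino is $P$ equals $\binom{k+\ell-2}{\ell-1}$.
   Context: A parallelogram polyomino is an edge-connected set of unit cells of the plane forming the interior of a contour made of two lattice paths with unit steps $(0,1)$ and $(1,0)$. The two paths meet only at their common start and at their common end. Its size is $k+\ell-1$ when its bounding rectangle is $k\times\ell$. A Baxter slicing of size $n$ is a parallelogram polyomino $P$ of size $n$ whose interior is divided into $n$ blocks, defined recursively: - for $n=1$, the single cell is the single block; - for $n\ge2$, one block is either the topmost row of $P$ (a horizontal block) or the rightmost column of $P$ (a vertical block), and the remaining $n-1$ blocks form a Baxter slicing of the polyomino obtained by deleting that row, respectively that column. -}

module Defs where

open import Data.Nat using (ℕ; zero; suc; _≤_)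
open import Data.List using (List; []; _∷_; length)
open import Data.List.Membership.Propositional using (_∈_)
open import Data.List.Relation.Unary.All using (All)
open import Data.List.Relation.Unary.Any using (Any)
open import Data.List.Relation.Unary.AllPairs using (AllPairs)
open import Data.Product using (_×_)
open import Function.Bundles using (_⇔_)
open import Relation.Nullary using (¬_)
open import Relation.Binary.PropositionalEquality using (_≡_)

-- Cells are unit squares [x,x+1]×[y,y+1] with (x , y) ∈ ℕ × ℕ.
-- The rectangular polyomino of width k and height ℓ is the set of cells
-- (x , y) with x < k and y < ℓ (x = column index from the left,
-- y = row index from the bottom).

-- A block which is a rectangle of cells: lower-left cell (x , y),
-- width w and height h.  All blocks arising below have w , h ≥ 1,
-- so a block is uniquely determined by its set of cells.
record Block : Set where
  constructor rect
  field
    x y w h : ℕ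

-- Deleting the
-- topmost row or rightmost column of a rectangle yields a rectangle,
-- so the recursive definition of the paper stays within rectangles.
--  * size 1: the single cell is the single block;
--  * horizontal: the topmost row of the k × (suc ℓ) rectangle is a block,
--    and the rest is a Baxter slicing of the k × ℓ rectangle (ℓ ≥ 1, so
--    what remains is a polyomino);
--  * vertical: the rightmost column of the (suc k) × ℓ rectangle is a
--    block, and the rest is a Baxter slicing of the k × ℓ rectangle.
data BaxterRect : ℕ → ℕ → List Block → Set where
  single : BaxterRect 1 1 (rect 0 0 1 1 ∷ [])
  horiz  : ∀ {k ℓ B} → 1 ≤ ℓ → BaxterRect k ℓ B →
           BaxterRect k (suc ℓ) (rect 0 ℓ k 1 ∷ B)
  vert   : ∀ {k ℓ B} → 1 ≤ k → BaxterRect k ℓ B →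
           BaxterRect (suc k) ℓ (rect k 0 1 ℓ ∷ B)

SameSlicing : List Block → List Block → Set
SameSlicing B B′ = ∀ b → (b ∈ B) ⇔ (b ∈ B′)

NumBaxterRect : ℕ → ℕ → ℕ → Set
NumBaxterRect k ℓ N =
  Data.Product.Σ (List (List Block)) λ L →
    All (BaxterRect k ℓ) L ×
    AllPairs (λ B B′ → ¬ SameSlicing B B′) L ×
    (∀ B → BaxterRect k ℓ B → Any (SameSlicing B) L) ×
    length L ≡ N

-- Deleting the top row or the right column of a rectangle leaves a rectangle,
-- so the slicings of the (1+a)×(1+b) rectangle are enumerated recursively: those
-- whose first block is the top row (possible when b ≥ 1) and those whose first
-- block is the right column (possible when a ≥ 1).  Their number then satisfies
-- Pascal's recurrence, giving (a+b) C b.  The enumeration is free of repetition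
-- because every block of a slicing lies inside its rectangle, whereas the block
-- removed at each step does not lie inside the remaining one; hence a slicing is
-- determined by its set of blocks.
module Submission where

open import Defs
open import Data.Nat using (ℕ; zero; suc; _≤_; _+_; _∸_; z≤n; s≤s)
open import Data.Nat.Combinatorics using (_C_; nCn≡1; nCk+nC[k+1]≡[n+1]C[k+1])
open import Data.Nat.Properties using (+-comm; +-suc; ≤-refl; ≤-reflexive; ≤-trans; n≤1+n; 1+n≰n; m+1+n≰m)
open import Data.List using (List; []; _∷_; map; _++_; length)
open import Data.List.Properties using (length-map; length-++; ∷-injectiveˡ; ∷-injectiveʳ)
open import Data.List.Membership.Propositional using (_∈_; _∉_)
open import Data.List.Membership.Propositional.Properties using (∈-map⁺; ∈-map⁻; ∈-++⁺ˡ; ∈-++⁺ʳ)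
open import Data.List.Relation.Unary.All as All using (All; []; _∷_)
import Data.List.Relation.Unary.All.Properties as All
open import Data.List.Relation.Unary.Any as Any using (here; there)
open import Data.List.Relation.Unary.AllPairs using (AllPairs; []; _∷_)
open import Data.List.Relation.Unary.Unique.Propositional using (Unique)
import Data.List.Relation.Unary.Unique.Propositional.Properties as Unique
open import Data.List.Relation.Binary.Disjoint.Propositional using (Disjoint)
open import Data.Product as Product using (_×_; _,_; proj₁; proj₂)
open import Data.Empty using (⊥-elim)
open import Function.Bundles using (Equivalence; mk⇔)
open import Function.Construct.Identity using (⇔-id)
open import Function.Construct.Symmetry using (⇔-sym)
open import Relation.Nullary using (¬_)
open import Relation.Binary.PropositionalEquality using (_≡_; _≢_; refl; sym; trans; cong; module ≡-Reasoning)
open ≡-Reasoning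

topRow : ℕ → ℕ → Block
topRow k ℓ = rect 0 ℓ k 1

rightColumn : ℕ → ℕ → Block
rightColumn k ℓ = rect k 0 1 ℓ

Within : ℕ → ℕ → Block → Set
Within k ℓ (rect x y w h) = x + w ≤ k × y + h ≤ ℓ

Within-mono : ∀ {k k′ ℓ ℓ′ c} → k ≤ k′ → ℓ ≤ ℓ′ → Within k ℓ c → Within k′ ℓ′ c
Within-mono k≤k′ ℓ≤ℓ′ = Product.map (λ p → ≤-trans p k≤k′) (λ q → ≤-trans q ℓ≤ℓ′)

blocks-within : ∀ {k ℓ B} → BaxterRect k ℓ B → All (Within k ℓ) B
blocks-within single = (≤-refl , ≤-refl) ∷ []
blocks-within (horiz {ℓ = ℓ} _ d) =
  (≤-refl , ≤-reflexive (+-comm ℓ 1)) ∷ All.map (λ {c} → Within-mono {c = c} ≤-refl (n≤1+n ℓ)) (blocks-within d)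
blocks-within (vert {k = k} _ d) =
  (≤-reflexive (+-comm k 1) , ≤-refl) ∷ All.map (λ {c} → Within-mono {c = c} (n≤1+n k) ≤-refl) (blocks-within d)

topRow∉ : ∀ {k ℓ B} → BaxterRect k ℓ B → topRow k ℓ ∉ B
topRow∉ {ℓ = ℓ} d t∈B = m+1+n≰m ℓ (proj₂ (All.lookup (blocks-within d) t∈B))

rightColumn∉ : ∀ {k ℓ B} → BaxterRect k ℓ B → rightColumn k ℓ ∉ B
rightColumn∉ {k} d r∈B = m+1+n≰m k (proj₁ (All.lookup (blocks-within d) r∈B))

sameSlicing-tail : ∀ {h T T′} → SameSlicing (h ∷ T) (h ∷ T′) → h ∉ T → h ∉ T′ → SameSlicing T T′
sameSlicing-tail {h} s h∉T h∉T′ c =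
  mk⇔ (dropHead h∉T (λ c∈T → Equivalence.to (s c) (there c∈T)))
      (dropHead h∉T′ (λ c∈T′ → Equivalence.from (s c) (there c∈T′)))
  where
  dropHead : ∀ {U V} → h ∉ U → (c ∈ U → c ∈ h ∷ V) → c ∈ U → c ∈ V
  dropHead h∉U f c∈U with f c∈U
  ... | here refl = ⊥-elim (h∉U c∈U)
  ... | there c∈V = c∈V

topRow≉rightColumn : ∀ {k ℓ T T′} → 1 ≤ k → BaxterRect k (suc ℓ) T′ →
  ¬ SameSlicing (topRow (suc k) ℓ ∷ T) (rightColumn k (suc ℓ) ∷ T′)
topRow≉rightColumn (s≤s z≤n) d′ s with Equivalence.to (s _) (here refl)
... | here ()
... | there t∈T′ = 1+n≰n (proj₁ (All.lookup (blocks-within d′) t∈T′))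

sameSlicing⇒≡ : ∀ {k ℓ B B′} → BaxterRect k ℓ B → BaxterRect k ℓ B′ → SameSlicing B B′ → B ≡ B′
sameSlicing⇒≡ single      single       _ = refl
sameSlicing⇒≡ single      (horiz () _) _
sameSlicing⇒≡ single      (vert () _)  _
sameSlicing⇒≡ (horiz () _) single      _
sameSlicing⇒≡ (vert () _)  single      _
sameSlicing⇒≡ (horiz _ d) (horiz _ d′) s =
  cong (_ ∷_) (sameSlicing⇒≡ d d′ (sameSlicing-tail s (topRow∉ d) (topRow∉ d′)))
sameSlicing⇒≡ (vert _ d)  (vert _ d′)  s =
  cong (_ ∷_) (sameSlicing⇒≡ d d′ (sameSlicing-tail s (rightColumn∉ d) (rightColumn∉ d′)))
sameSlicing⇒≡ (horiz _ _)  (vert 1≤k d′) s = ⊥-elim (topRow≉rightColumn 1≤k d′ s)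
sameSlicing⇒≡ (vert 1≤k d) (horiz _ _)   s = ⊥-elim (topRow≉rightColumn 1≤k d (λ c → ⇔-sym (s c)))

slicings : ℕ → ℕ → List (List Block)
slicings zero    zero    = (rect 0 0 1 1 ∷ []) ∷ []
slicings zero    (suc b) = map (topRow 1 (suc b) ∷_) (slicings zero b)
slicings (suc a) zero    = map (rightColumn (suc a) 1 ∷_) (slicings a zero)
slicings (suc a) (suc b) = map (topRow (suc (suc a)) (suc b) ∷_) (slicings (suc a) b)
                        ++ map (rightColumn (suc a) (suc (suc b)) ∷_) (slicings a (suc b))

slicings-sound : ∀ a b → All (BaxterRect (suc a) (suc b)) (slicings a b)
slicings-sound zero    zero    = single ∷ []
slicings-sound zero    (suc b) = All.map⁺ (All.map (horiz (s≤s z≤n)) (slicings-sound zero b))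
slicings-sound (suc a) zero    = All.map⁺ (All.map (vert (s≤s z≤n)) (slicings-sound a zero))
slicings-sound (suc a) (suc b) = All.++⁺
  (All.map⁺ (All.map (horiz (s≤s z≤n)) (slicings-sound (suc a) b)))
  (All.map⁺ (All.map (vert (s≤s z≤n)) (slicings-sound a (suc b))))

slicings-complete : ∀ {a b B} → BaxterRect (suc a) (suc b) B → B ∈ slicings a b
slicings-complete single = here refl
slicings-complete {zero}          (horiz (s≤s z≤n) d) = ∈-map⁺ _ (slicings-complete d)
slicings-complete {suc a}         (horiz (s≤s z≤n) d) = ∈-++⁺ˡ (∈-map⁺ _ (slicings-complete d))
slicings-complete {b = zero}      (vert (s≤s z≤n) d)  = ∈-map⁺ _ (slicings-complete d)
slicings-complete {suc a} {suc b} (vert (s≤s z≤n) d)  = ∈-++⁺ʳ _ (∈-map⁺ _ (slicings-complete d))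

map-∷-disjoint : ∀ {A : Set} {h h′ : A} {X Y} → h ≢ h′ → Disjoint (map (h ∷_) X) (map (h′ ∷_) Y)
map-∷-disjoint h≢h′ (m , m′) with ∈-map⁻ _ m | ∈-map⁻ _ m′
... | _ , _ , refl | _ , _ , eq = h≢h′ (∷-injectiveˡ eq)

slicings-unique : ∀ a b → Unique (slicings a b)
slicings-unique zero    zero    = [] ∷ []
slicings-unique zero    (suc b) = Unique.map⁺ ∷-injectiveʳ (slicings-unique zero b)
slicings-unique (suc a) zero    = Unique.map⁺ ∷-injectiveʳ (slicings-unique a zero)
slicings-unique (suc a) (suc b) = Unique.++⁺
  (Unique.map⁺ ∷-injectiveʳ (slicings-unique (suc a) b))
  (Unique.map⁺ ∷-injectiveʳ (slicings-unique a (suc b)))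
  (map-∷-disjoint λ ())

AllPairs-strengthen : ∀ {A : Set} {P : A → Set} {R S : A → A → Set} →
  (∀ {x y} → P x → P y → R x y → S x y) → ∀ {xs} → All P xs → AllPairs R xs → AllPairs S xs
AllPairs-strengthen f [] [] = []
AllPairs-strengthen f (px ∷ pxs) (rx ∷ rxs) =
  All.zipWith (λ (py , r) → f px py r) (pxs , rx) ∷ AllPairs-strengthen f pxs rxs

slicings-distinct : ∀ a b → AllPairs (λ B B′ → ¬ SameSlicing B B′) (slicings a b)
slicings-distinct a b = AllPairs-strengthen (λ d d′ B≢B′ s → B≢B′ (sameSlicing⇒≡ d d′ s))
  (slicings-sound a b) (slicings-unique a b)

length-slicings : ∀ a b → length (slicings a b) ≡ (a + b) C b
length-slicings zero zero = refl
length-slicings zero (suc b) = begin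
  length (map _ (slicings zero b)) ≡⟨ length-map _ (slicings zero b) ⟩
  length (slicings zero b)         ≡⟨ length-slicings zero b ⟩
  b C b                            ≡⟨ nCn≡1 b ⟩
  1                                ≡⟨ nCn≡1 (suc b) ⟨
  suc b C suc b                    ∎
length-slicings (suc a) zero = trans (length-map _ (slicings a zero)) (length-slicings a zero)
length-slicings (suc a) (suc b) = begin
  length (map _ (slicings (suc a) b) ++ map _ (slicings a (suc b)))
    ≡⟨ length-++ (map _ (slicings (suc a) b)) ⟩
  length (map _ (slicings (suc a) b)) + length (map _ (slicings a (suc b)))
    ≡⟨ cong₂-+ (length-map _ (slicings (suc a) b)) (length-map _ (slicings a (suc b))) ⟩
  length (slicings (suc a) b) + length (slicings a (suc b))
    ≡⟨ cong₂-+ (length-slicings (suc a) b) (length-slicings a (suc b)) ⟩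
  suc (a + b) C b + (a + suc b) C suc b
    ≡⟨ cong (λ n → n C b + (a + suc b) C suc b) (sym (+-suc a b)) ⟩
  (a + suc b) C b + (a + suc b) C suc b
    ≡⟨ nCk+nC[k+1]≡[n+1]C[k+1] (a + suc b) b ⟩
  suc (a + suc b) C suc b ∎
  where
  cong₂-+ : ∀ {m m′ n n′ : ℕ} → m ≡ m′ → n ≡ n′ → m + n ≡ m′ + n′
  cong₂-+ refl refl = refl

mainTheorem3 : ∀ (k ℓ : ℕ) → 1 ≤ k → 1 ≤ ℓ →
    NumBaxterRect k ℓ ((k + ℓ ∸ 2) C (ℓ ∸ 1))
mainTheorem3 (suc a) (suc b) (s≤s z≤n) (s≤s z≤n) =
  slicings a b ,
  slicings-sound a b ,
  slicings-distinct a b ,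
  (λ B d → Any.map (λ { refl c → ⇔-id _ }) (slicings-complete d)) ,
  trans (length-slicings a b) (cong (λ n → (n ∸ 1) C b) (sym (+-suc a b)))
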